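{- Let $u,v\ge 1$ be integers and let $z$ be a positive rational number in lowest terms. Then the following are equivalent: (i) for every integer $n\ge 0$ and every $i=1,\dots,2^n-1$, the denominator of $c_z^{(u,v)}(n,i)$ (in lowest terms) equals the numerator of $c_z^{(u,v)}(n,i+1)$ (in lowest terms); (ii) $u=v=1$.
   Context: For integers $u,v\ge 1$ and a positive rational $z$, the $(u,v)$-Calkin–Wilf tree $\mathcal{T}^{(u,v)}(z)$ is the infinite binary tree with root $z$ in which every vertex $w$ has left child $w/(uw+1)$ and right child $w+v$. Rows are numbered from $0$ (row $0$ is the root), so row $n$ has $2^n$ vertices; $c_z^{(u,v)}(n,i)$ denotes the $i$-th vertex from the left in row $n$ (the left and right children of the $k$-th vertex of row $n$ are the $(2k-1)$-th and $2k$-th vertices of row $n+1$). -}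

module Defs where

open import Data.Nat as ℕ using (ℕ; zero; suc)
open import Data.Integer as ℤ using (ℤ; +_)
open import Data.Rational
open import Data.Rational.Properties
open import Data.Product using (Σ; _,_; proj₁)
open import Data.List using (List; []; _∷_; concatMap)

-- Positive rationals (ℚ is always stored in lowest terms).
ℚ⁺ : Set
ℚ⁺ = Σ ℚ Positive

ℕ→ℚ : ℕ → ℚ
ℕ→ℚ n = + n / 1

ℕ→ℚ-nonNeg : ∀ n → NonNegative (ℕ→ℚ n)
ℕ→ℚ-nonNeg zero = _
ℕ→ℚ-nonNeg (suc n) = pos⇒nonNeg (ℕ→ℚ (suc n)) {{normalize-pos (suc n) 1}}

-- Left child  w ↦ w / (u w + 1)  of the (u,v)-Calkin–Wilf tree.
leftChild : ℕ → ℚ⁺ → ℚ⁺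
leftChild u (w , pw) =
  (_÷_ w d {{nzd}}) , pos*pos⇒pos w {{pw}} ((1/ d) {{nzd}}) {{1/pos⇒pos d {{pd}}}}
  where
  d : ℚ
  d = ℕ→ℚ u * w + 1ℚ
  pd : Positive d
  pd = nonNeg+pos⇒pos (ℕ→ℚ u * w)
         {{nonNeg*nonNeg⇒nonNeg (ℕ→ℚ u) {{ℕ→ℚ-nonNeg u}} w {{pos⇒nonNeg w {{pw}}}}}} 1ℚ
  nzd : NonZero d
  nzd = pos⇒nonZero d {{pd}}

rightChild : ℕ → ℚ⁺ → ℚ⁺
rightChild v (w , pw) =
  (w + ℕ→ℚ v) , pos+nonNeg⇒pos w {{pw}} (ℕ→ℚ v) {{ℕ→ℚ-nonNeg v}}

row : ℕ → ℕ → ℚ⁺ → ℕ → List ℚ⁺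
row u v z zero    = z ∷ []
row u v z (suc n) = concatMap (λ w → leftChild u w ∷ rightChild v w ∷ []) (row u v z n)

-- k-th element (0-based) of a list; default 0 if out of range (never used below).
nth : List ℚ → ℕ → ℚ
nth []       _       = 0ℚ
nth (x ∷ xs) zero    = x
nth (x ∷ xs) (suc k) = nth xs k

-- c_z^(u,v)(n,i): the i-th vertex (1-based, 1 ≤ i ≤ 2^n) of row n.
c : ℕ → ℕ → ℚ⁺ → ℕ → ℕ → ℚ
c u v z n i = nth (Data.List.map proj₁ (row u v z n)) (i ℕ.∸ 1)

{-# OPTIONS --safe #-}
-- In lowest terms the left child of p/q is p/(q + u p) and the right child is (p + v q)/q, since
-- adding multiples of one entry to the other preserves coprimality. So a left child keeps its
-- parent's numerator and a right child its parent's denominator: between consecutive vertices that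
-- are not siblings the condition is inherited from the previous row, while for the two children of
-- p/q it reads q + u p = p + v q, an identity when u = v = 1. Conversely, this sibling condition at
-- z = p/q and at its left child p/(q + u p) gives q + u p = p + v q and q + 2 u p = p + v (q + u p),
-- whence u p = v u p, so v = 1, and then u = 1.
module Submission where

open import Defs
open import Data.Nat as ℕ using (ℕ; zero; suc; _+_; _*_; _≤_; _<_; _^_; s≤s; z≤n)
import Data.Nat.Properties as ℕ
open import Data.Nat.Divisibility using (_∣_; ∣m+n∣m⇒∣n; ∣n⇒∣m*n)
open import Data.Nat.Coprimality as Coprimality using (Coprime)
open import Data.Nat.Tactic.RingSolver as ℕ-Solver using ()
open import Data.Integer as ℤ using (+_; +[1+_]; +0; -[1+_])
import Data.Integer.Properties as ℤ
open import Data.Integer.Tactic.RingSolver as ℤ-Solver using ()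
open import Data.Rational as ℚ using (ℚ; mkℚ; ↥_; ↧_; _÷_; 1ℚ)
import Data.Rational.Properties as ℚ
import Data.Rational.Unnormalised as ℚᵘ
import Data.Rational.Unnormalised.Properties as ℚᵘ
open import Data.List using (List; []; _∷_; concatMap; length; map)
open import Data.List.Properties using (length-map)
open import Data.List.Relation.Unary.Linked using (Linked; []; [-]; _∷_)
open import Data.List.Relation.Unary.Linked.Properties using (map⁺)
open import Data.Product using (_×_; _,_; proj₁)
open import Function using (_on_)
open import Function.Bundles using (_⇔_; mk⇔; Equivalence)
open import Level using (0ℓ)
open import Relation.Binary using (Rel)
open import Relation.Binary.PropositionalEquality

coprime-+-* : ∀ k {m n} → Coprime m n → Coprime (m + k * n) n
coprime-+-* k {m} {n} m⊥n {i} (i∣m+kn , i∣n) =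
  m⊥n (∣m+n∣m⇒∣n (subst (i ∣_) (ℕ.+-comm m (k * n)) i∣m+kn) (∣n⇒∣m*n k i∣n) , i∣n)

pos-+-* : ∀ a b c → + (a + b * c) ≡ + a ℤ.+ + b ℤ.* + c
pos-+-* a b c = trans (ℤ.pos-+ a (b * c)) (cong (λ k → + a ℤ.+ k) (ℤ.pos-* b c))

p*q≡r⇒r÷q≡p : ∀ p q r .{{_ : ℚ.NonZero q}} → p ℚ.* q ≡ r → r ÷ q ≡ p
p*q≡r⇒r÷q≡p p q r pq≡r = begin
  r ℚ.* ℚ.1/ q        ≡⟨ cong (ℚ._* ℚ.1/ q) pq≡r ⟨
  p ℚ.* q ℚ.* ℚ.1/ q  ≡⟨ ℚ.*-assoc p q (ℚ.1/ q) ⟩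
  p ℚ.* (q ℚ.* ℚ.1/ q) ≡⟨ cong (p ℚ.*_) (ℚ.*-inverseʳ q) ⟩
  p ℚ.* 1ℚ            ≡⟨ ℚ.*-identityʳ p ⟩
  p                   ∎
  where open ≡-Reasoning

Linked⇒nth : ∀ {ℓ} {R : Rel ℚ ℓ} {xs} → Linked R xs →
  ∀ k → suc k < length xs → R (nth xs k) (nth xs (suc k))
Linked⇒nth (r ∷ _)  zero    _           = r
Linked⇒nth (_ ∷ rs) (suc k) (s≤s k<len) = Linked⇒nth rs k k<len
Linked⇒nth [-]      _       (s≤s ())

-- In these names q = suc d, as mkℚᵘ n d stands for n / (d + 1).
m/q+v≃[m+vq]/q : ∀ m d v →
  ℚᵘ.mkℚᵘ (+ m) d ℚᵘ.+ ℚᵘ.mkℚᵘ (+ v) 0 ℚᵘ.≃ ℚᵘ.mkℚᵘ (+ (m + v * suc d)) d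
m/q+v≃[m+vq]/q m d v = ℚᵘ.*≡* (begin
  (+ m ℤ.* + 1 ℤ.+ + v ℤ.* + suc d) ℤ.* + suc d
    ≡⟨ cong (λ k → (k ℤ.+ + v ℤ.* + suc d) ℤ.* + suc d) (ℤ.*-identityʳ (+ m)) ⟩
  (+ m ℤ.+ + v ℤ.* + suc d) ℤ.* + suc d
    ≡⟨ cong₂ ℤ._*_ (sym (pos-+-* m v (suc d))) (cong (λ k → + suc k) (sym (ℕ.*-identityʳ d))) ⟩
  + (m + v * suc d) ℤ.* + suc (d * 1) ∎)
  where open ≡-Reasoning

m/[q+um]*[u*m/q+1]≃m/q : ∀ m d u →
  ℚᵘ.mkℚᵘ (+ m) (d + u * m) ℚᵘ.* (ℚᵘ.mkℚᵘ (+ u) 0 ℚᵘ.* ℚᵘ.mkℚᵘ (+ m) d ℚᵘ.+ ℚᵘ.1ℚᵘ)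
    ℚᵘ.≃ ℚᵘ.mkℚᵘ (+ m) d
m/[q+um]*[u*m/q+1]≃m/q m d u = ℚᵘ.*≡* (begin
  M ℤ.* (U ℤ.* M ℤ.* + 1 ℤ.+ + 1 ℤ.* + suc (d + 0)) ℤ.* Q
    ≡⟨ cong (λ k → M ℤ.* (U ℤ.* M ℤ.* + 1 ℤ.+ + 1 ℤ.* k) ℤ.* Q) q+0≡q ⟩
  M ℤ.* (U ℤ.* M ℤ.* + 1 ℤ.+ + 1 ℤ.* Q) ℤ.* Q
    ≡⟨ regroup M U Q ⟩
  M ℤ.* ((Q ℤ.+ U ℤ.* M) ℤ.* (Q ℤ.* + 1))
    ≡⟨ cong (M ℤ.*_) (sym denominator≡) ⟩
  M ℤ.* + (suc (d + u * m) * (suc (d + 0) * 1)) ∎)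
  where
  open ≡-Reasoning
  M = + m
  U = + u
  Q = + suc d
  q+0≡q : + suc (d + 0) ≡ Q
  q+0≡q = cong (λ k → + suc k) (ℕ.+-identityʳ d)
  regroup : ∀ M U Q →
    M ℤ.* (U ℤ.* M ℤ.* + 1 ℤ.+ + 1 ℤ.* Q) ℤ.* Q ≡ M ℤ.* ((Q ℤ.+ U ℤ.* M) ℤ.* (Q ℤ.* + 1))
  regroup = ℤ-Solver.solve-∀
  denominator≡ : + (suc (d + u * m) * (suc (d + 0) * 1)) ≡ (Q ℤ.+ U ℤ.* M) ℤ.* (Q ℤ.* + 1)
  denominator≡ = trans (ℤ.pos-* (suc (d + u * m)) (suc (d + 0) * 1))
    (cong₂ ℤ._*_ (pos-+-* (suc d) u m) (trans (ℤ.pos-* (suc (d + 0)) 1) (cong (ℤ._* + 1) q+0≡q)))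

ℕ→ℚ≡mkℚ : ∀ n → ℕ→ℚ n ≡ mkℚ (+ n) 0 (Coprimality.sym (Coprimality.1-coprimeTo n))
ℕ→ℚ≡mkℚ n = ℚ.normalize-coprime _

rightChild-mkℚ : ∀ v (w : ℚ⁺) {m d} .{c : Coprime m (suc d)} → proj₁ w ≡ mkℚ (+ m) d c →
  proj₁ (rightChild v w) ≡ mkℚ (+ (m + v * suc d)) d (coprime-+-* v (Coprimality.recompute c))
rightChild-mkℚ v (x , _) {m} {d} refl = ℚ.toℚᵘ-injective (begin
  ℚ.toℚᵘ (x ℚ.+ ℕ→ℚ v)                     ≈⟨ ℚ.toℚᵘ-homo-+ x (ℕ→ℚ v) ⟩
  ℚ.toℚᵘ x ℚᵘ.+ ℚ.toℚᵘ (ℕ→ℚ v)              ≡⟨ cong (λ y → ℚ.toℚᵘ x ℚᵘ.+ ℚ.toℚᵘ y) (ℕ→ℚ≡mkℚ v) ⟩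
  ℚᵘ.mkℚᵘ (+ m) d ℚᵘ.+ ℚᵘ.mkℚᵘ (+ v) 0     ≈⟨ m/q+v≃[m+vq]/q m d v ⟩
  ℚᵘ.mkℚᵘ (+ (m + v * suc d)) d             ∎)
  where open ℚᵘ.≃-Reasoning

leftChild-mkℚ : ∀ u (w : ℚ⁺) {m d} .{c : Coprime m (suc d)} → proj₁ w ≡ mkℚ (+ m) d c →
  proj₁ (leftChild u w) ≡
    mkℚ (+ m) (d + u * m) (Coprimality.sym (coprime-+-* u (Coprimality.sym (Coprimality.recompute c))))
leftChild-mkℚ u (x , _) {m} {d} {c} refl = p*q≡r⇒r÷q≡p t D x {{D≢0}} (ℚ.toℚᵘ-injective (begin
  ℚ.toℚᵘ (t ℚ.* D)                                              ≈⟨ ℚ.toℚᵘ-homo-* t D ⟩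
  ℚᵘ.mkℚᵘ (+ m) (d + u * m) ℚᵘ.* ℚ.toℚᵘ D                       ≈⟨ ℚᵘ.*-congˡ toℚᵘ-D ⟩
  ℚᵘ.mkℚᵘ (+ m) (d + u * m) ℚᵘ.* (ℚᵘ.mkℚᵘ (+ u) 0 ℚᵘ.* ℚ.toℚᵘ x ℚᵘ.+ ℚᵘ.1ℚᵘ)
                                                                ≈⟨ m/[q+um]*[u*m/q+1]≃m/q m d u ⟩
  ℚ.toℚᵘ x                                                      ∎))
  where
  open ℚᵘ.≃-Reasoning
  t = mkℚ (+ m) (d + u * m) (Coprimality.sym (coprime-+-* u (Coprimality.sym (Coprimality.recompute c))))
  D = ℕ→ℚ u ℚ.* x ℚ.+ 1ℚ
  D≢0 : ℚ.NonZero D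
  D≢0 = ℚ.pos⇒nonZero D
    {{ℚ.nonNeg+pos⇒pos (ℕ→ℚ u ℚ.* x) {{ℚ.nonNeg*nonNeg⇒nonNeg (ℕ→ℚ u) {{ℕ→ℚ-nonNeg u}} x}} 1ℚ}}
  toℚᵘ-D : ℚ.toℚᵘ D ℚᵘ.≃ ℚᵘ.mkℚᵘ (+ u) 0 ℚᵘ.* ℚ.toℚᵘ x ℚᵘ.+ ℚᵘ.1ℚᵘ
  toℚᵘ-D = begin
    ℚ.toℚᵘ D                                         ≈⟨ ℚ.toℚᵘ-homo-+ (ℕ→ℚ u ℚ.* x) 1ℚ ⟩
    ℚ.toℚᵘ (ℕ→ℚ u ℚ.* x) ℚᵘ.+ ℚᵘ.1ℚᵘ                 ≈⟨ ℚᵘ.+-congˡ ℚᵘ.1ℚᵘ (ℚ.toℚᵘ-homo-* (ℕ→ℚ u) x) ⟩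
    ℚ.toℚᵘ (ℕ→ℚ u) ℚᵘ.* ℚ.toℚᵘ x ℚᵘ.+ ℚᵘ.1ℚᵘ        ≡⟨ cong (λ y → ℚ.toℚᵘ y ℚᵘ.* ℚ.toℚᵘ x ℚᵘ.+ ℚᵘ.1ℚᵘ) (ℕ→ℚ≡mkℚ u) ⟩
    ℚᵘ.mkℚᵘ (+ u) 0 ℚᵘ.* ℚ.toℚᵘ x ℚᵘ.+ ℚᵘ.1ℚᵘ       ∎

Adjacent : Rel ℚ 0ℓ
Adjacent x y = ↧ x ≡ ↥ y

siblings-adjacent⇔ : ∀ u v (w : ℚ⁺) {m d} .{c : Coprime m (suc d)} → proj₁ w ≡ mkℚ (+ m) d c →
  Adjacent (proj₁ (leftChild u w)) (proj₁ (rightChild v w)) ⇔ suc d + u * m ≡ m + v * suc d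
siblings-adjacent⇔ u v w w≡ rewrite leftChild-mkℚ u w w≡ | rightChild-mkℚ v w w≡ =
  mk⇔ ℤ.+-injective (cong (λ k → + k))

siblings-adjacent-1-1 : ∀ w → Adjacent (proj₁ (leftChild 1 w)) (proj₁ (rightChild 1 w))
siblings-adjacent-1-1 w@(mkℚ (+ m) d _ , _) =
  Equivalence.from (siblings-adjacent⇔ 1 1 w refl) (q+m≡m+q (suc d) m)
  where
  q+m≡m+q : ∀ q m → q + 1 * m ≡ m + 1 * q
  q+m≡m+q = ℕ-Solver.solve-∀
siblings-adjacent-1-1 (mkℚ -[1+ _ ] _ _ , ())

↥-leftChild : ∀ u (w : ℚ⁺) → ↥ proj₁ (leftChild u w) ≡ ↥ proj₁ w
↥-leftChild u w@(mkℚ (+ _) _ _ , _) = cong ↥_ (leftChild-mkℚ u w refl)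
↥-leftChild u (mkℚ -[1+ _ ] _ _ , ())

↧-rightChild : ∀ v (w : ℚ⁺) → ↧ proj₁ (rightChild v w) ≡ ↧ proj₁ w
↧-rightChild v w@(mkℚ (+ _) _ _ , _) = cong ↧_ (rightChild-mkℚ v w refl)
↧-rightChild v (mkℚ -[1+ _ ] _ _ , ())

cousins-adjacent : ∀ u v (w w′ : ℚ⁺) → Adjacent (proj₁ w) (proj₁ w′) →
  Adjacent (proj₁ (rightChild v w)) (proj₁ (leftChild u w′))
cousins-adjacent u v w w′ w⌢w′ = trans (↧-rightChild v w) (trans w⌢w′ (sym (↥-leftChild u w′)))

children : ℕ → ℕ → ℚ⁺ → List ℚ⁺
children u v w = leftChild u w ∷ rightChild v w ∷ []

length-concatMap-children : ∀ u v ws → length (concatMap (children u v) ws) ≡ 2 * length ws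
length-concatMap-children u v []       = refl
length-concatMap-children u v (_ ∷ ws) =
  trans (cong (λ k → suc (suc k)) (length-concatMap-children u v ws)) (sym (ℕ.*-suc 2 (length ws)))

length-row : ∀ u v z n → length (row u v z n) ≡ 2 ^ n
length-row u v z zero    = refl
length-row u v z (suc n) =
  trans (length-concatMap-children u v (row u v z n)) (cong (2 *_) (length-row u v z n))

concatMap-children-linked : ∀ u v {ws} →
  (∀ w → Adjacent (proj₁ (leftChild u w)) (proj₁ (rightChild v w))) →
  Linked (Adjacent on proj₁) ws → Linked (Adjacent on proj₁) (concatMap (children u v) ws)
concatMap-children-linked u v siblings []                          = []
concatMap-children-linked u v siblings ([-] {w})                   = siblings w ∷ [-]
concatMap-children-linked u v siblings (_∷_ {w} {w′} w⌢w′ w′∷ws) =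
  siblings w ∷ cousins-adjacent u v w w′ w⌢w′ ∷ concatMap-children-linked u v siblings w′∷ws

row-1-1-linked : ∀ z n → Linked (Adjacent on proj₁) (row 1 1 z n)
row-1-1-linked z zero    = [-]
row-1-1-linked z (suc n) = concatMap-children-linked 1 1 siblings-adjacent-1-1 (row-1-1-linked z n)

sibling-equations⇒u≡1×v≡1 : ∀ {u v m q} .{{_ : ℕ.NonZero u}} .{{_ : ℕ.NonZero m}} →
  q + u * m ≡ m + v * q → q + u * m + u * m ≡ m + v * (q + u * m) → u ≡ 1 × v ≡ 1
sibling-equations⇒u≡1×v≡1 {u} {v} {m} {q} e₁ e₂ = u≡1 , v≡1
  where
  open ≡-Reasoning
  regroup : ∀ m v q x → m + v * (q + x) ≡ v * x + (m + v * q)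
  regroup = ℕ-Solver.solve-∀
  um≡v*um : u * m ≡ v * (u * m)
  um≡v*um = ℕ.+-cancelʳ-≡ (m + v * q) (u * m) (v * (u * m)) (begin
    u * m + (m + v * q)  ≡⟨ cong (_+_ (u * m)) e₁ ⟨
    u * m + (q + u * m)  ≡⟨ ℕ.+-comm (u * m) (q + u * m) ⟩
    q + u * m + u * m    ≡⟨ e₂ ⟩
    m + v * (q + u * m)  ≡⟨ regroup m v q (u * m) ⟩
    v * (u * m) + (m + v * q) ∎)
  v≡1 : v ≡ 1
  v≡1 = sym (ℕ.*-cancelʳ-≡ 1 v (u * m) {{ℕ.m*n≢0 u m}} (trans (ℕ.*-identityˡ (u * m)) um≡v*um))
  um≡m : u * m ≡ m
  um≡m = ℕ.+-cancelˡ-≡ q (u * m) m (begin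
    q + u * m  ≡⟨ e₁ ⟩
    m + v * q  ≡⟨ cong (λ k → m + k * q) v≡1 ⟩
    m + 1 * q  ≡⟨ cong (_+_ m) (ℕ.*-identityˡ q) ⟩
    m + q      ≡⟨ ℕ.+-comm m q ⟩
    q + m      ∎)
  u≡1 : u ≡ 1
  u≡1 = ℕ.*-cancelʳ-≡ u 1 m (trans um≡m (sym (ℕ.*-identityˡ m)))

RowsAdjacent : ℕ → ℕ → ℚ⁺ → Set
RowsAdjacent u v z = ∀ n i → 1 ≤ i → i < 2 ^ n → Adjacent (c u v z n i) (c u v z n (i + 1))

rowsAdjacent⇒u≡1×v≡1 : ∀ {u v} → 1 ≤ u → (z : ℚ⁺) → RowsAdjacent u v z → u ≡ 1 × v ≡ 1
rowsAdjacent⇒u≡1×v≡1 {u} {v} 1≤u z@(mkℚ +[1+ _ ] _ _ , _) adjacent =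
  sibling-equations⇒u≡1×v≡1 {{ℕ.>-nonZero 1≤u}}
    (Equivalence.to (siblings-adjacent⇔ u v z refl) (adjacent 1 1 ℕ.≤-refl (s≤s (s≤s z≤n))))
    (Equivalence.to (siblings-adjacent⇔ u v (leftChild u z) (leftChild-mkℚ u z refl))
      (adjacent 2 1 ℕ.≤-refl (s≤s (s≤s z≤n))))
rowsAdjacent⇒u≡1×v≡1 _ (mkℚ +0 _ _ , ()) _
rowsAdjacent⇒u≡1×v≡1 _ (mkℚ -[1+ _ ] _ _ , ()) _

rowsAdjacent-1-1 : ∀ z → RowsAdjacent 1 1 z
rowsAdjacent-1-1 z n (suc k) _ 1+k<2^n rewrite ℕ.+-comm k 1 =
  Linked⇒nth (map⁺ (row-1-1-linked z n)) k (begin-strict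
    suc k                            <⟨ 1+k<2^n ⟩
    2 ^ n                            ≡⟨ length-row 1 1 z n ⟨
    length (row 1 1 z n)             ≡⟨ length-map proj₁ (row 1 1 z n) ⟨
    length (map proj₁ (row 1 1 z n)) ∎)
  where open ℕ.≤-Reasoning

proposition3p2 : (u v : ℕ) → 1 ≤ u → 1 ≤ v → (z : ℚ⁺) →
    ((∀ (n i : ℕ) → 1 ≤ i → i < 2 ^ n →
        ↧ (c u v z n i) ≡ ↥ (c u v z n (i + 1)))
    ⇔ (u ≡ 1 × v ≡ 1))
proposition3p2 u v 1≤u _ z =
  mk⇔ (rowsAdjacent⇒u≡1×v≡1 1≤u z) (λ { (refl , refl) → rowsAdjacent-1-1 z })
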